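{- For $n\ge 2$, let $Z^*_n=\mathsf{N}(\mathsf{N}\mathsf{E})^{n-1}\mathsf{E}\in\mathcal{D}_n$. Then $\mathsf{traj}(Z^*_n)$ is odd if $n\equiv 0,1\pmod 4$ and even if $n\equiv 2,3\pmod 4$.
   Context: A Dyck path of size $n$ is a lattice path in $\mathbb{Z}^2$ from $(0,0)$ to $(n,n)$ using steps $\mathsf{N}=(0,1)$ and $\mathsf{E}=(1,0)$ that never goes below $y=x$; $\mathcal{D}_n$ is the set of such paths. For a Dyck path $P$, $-P$ is its reflection over $y=x$. For $P,Q\in\mathcal{D}_n$, the grid polygon associated with $(P,Q)$ is the region enclosed by $P$ and $-Q$; its boundary consists of the $4n$ unit steps of $P$ and $-Q$. From the midpoint of any boundary step, emit a light beam into the interior making a $45^\circ$ angle with that step; it travels straight until it reaches the midpoint of another boundary step (meeting it at $45^\circ$). This defines a permutation of the $4n$ boundary steps; $\mathsf{traj}(P,Q)$ is its number of cycles. For $P\in\mathcal{D}_n$, $\mathsf{traj}(P)=\mathsf{traj}(P,\mathsf{N}^n\mathsf{E}^n)$. -}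

module Defs where

open import Data.Bool using (Bool; true; false; _∧_)
open import Data.Nat using (ℕ; zero; suc; _≤ᵇ_; _∸_; _<?_; _+_)
open import Data.Integer as ℤ using (ℤ; +_; -_)
open import Data.List using (List; []; _∷_; _++_; map; length; filterᵇ; replicate; concat; upTo; lookup)
open import Data.Fin using (fromℕ<)
open import Data.Maybe using (Maybe; just; nothing)
open import Data.Product using (_×_; _,_)
open import Relation.Nullary using (yes; no)
open import Data.Product.Properties using (≡-dec)

data Step : Set where
  N E : Step

Path : Set
Path = List Step

-- Points of the plane in DOUBLED coordinates (so that midpoints of unit
-- steps have integer coordinates).
Pt : Set
Pt = ℤ × ℤ

_⊕_ : Pt → Pt → Pt
(a , b) ⊕ (c , d) = (a ℤ.+ c , b ℤ.+ d)

stepDir : Step → Pt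
stepDir N = (+ 0 , + 1)
stepDir E = (+ 1 , + 0)

-- A boundary step is recorded as (midpoint, unit direction of traversal),
-- both in doubled coordinates.
BStep : Set
BStep = Pt × Pt

walk : Pt → Path → List BStep
walk v [] = []
walk v (s ∷ ss) = (v ⊕ stepDir s , stepDir s) ∷ walk (v ⊕ (stepDir s ⊕ stepDir s)) ss

refl-step : Step → Step
refl-step N = E
refl-step E = N

-- Boundary of the grid polygon of (P,Q), traversed as a closed clockwise loop:
-- P from (0,0) to (n,n), then -Q backwards from (n,n) to (0,0)
-- (so directions of the steps of -Q are negated).
boundary : Path → Path → List BStep
boundary P Q =
  walk (+ 0 , + 0) P ++
  map (λ { (m , (a , b)) → (m , (- a , - b)) }) (walk (+ 0 , + 0) (map refl-step Q))

-- Emission direction: 45° clockwise from the traversal direction, i.e. into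
-- the interior (the interior lies to the right of a clockwise loop).
-- For the unit direction (a,b) this is the diagonal vector (a+b, b-a)
-- (one diagonal move in doubled coordinates goes from an edge midpoint to
-- the next edge midpoint).  The other interior ray of the step is obtained
-- by reflection, so a trajectory may equally be started on either ray.
emit : Pt → Pt
emit (a , b) = (a ℤ.+ b , b ℤ.- a)

indexOf : Pt → List BStep → Maybe ℕ
indexOf p [] = nothing
indexOf p ((m , _) ∷ bs) with ≡-dec ℤ._≟_ ℤ._≟_ p m
... | yes _ = just 0
... | no _ with indexOf p bs
...   | just i = just (suc i)
...   | nothing = nothing

-- Travel in a straight line from midpoint m in diagonal direction d until
-- the first boundary midpoint is reached (fuel bounds the number of
-- diagonal moves; length B = 4n moves always suffice since a beam crosses
-- at most 2n cells).
travel : List BStep → ℕ → Pt → Pt → Maybe ℕ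
travel B zero m d = nothing
travel B (suc f) m d with indexOf (m ⊕ d) B
... | just i = just i
... | nothing = travel B f (m ⊕ d) d

-- Reflection of a diagonal direction d at a step with unit direction u
-- (horizontal step: flip the vertical component; vertical: flip the
-- horizontal component).
reflectAt : Pt → Pt → Pt
reflectAt (+ 0 , _) (dx , dy) = (- dx , dy)
reflectAt _         (dx , dy) = (dx , - dy)

State : Set
State = ℕ × Pt

-- One segment of the light beam: from step i in direction d, travel to the
-- next boundary step j, and continue from j with the reflected direction.
-- (Fallback values are never used for genuine inputs.)
next : List BStep → State → State
next B (i , d) with i <? length B
... | no _ = (i , d)
... | yes i< with lookup B (fromℕ< i<)
...   | (m , _) with travel B (length B) m d
...     | nothing = (i , d)
...     | just j with j <? length B
...       | no _ = (i , d)
...       | yes j< with lookup B (fromℕ< j<)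
...         | (_ , u') = (j , reflectAt u' d)

iter : {A : Set} → (A → A) → ℕ → A → A
iter f zero x = x
iter f (suc k) x = iter f k (f x)

allᵇ : (ℕ → Bool) → List ℕ → Bool
allᵇ p [] = true
allᵇ p (x ∷ xs) = p x ∧ allᵇ p xs

index : State → ℕ
index (i , _) = i

-- Step i is the least-indexed step met by the light trajectory through it.
-- (Beam states number 2·4n, so the orbit is exhausted after 2·length B moves.)
isLeader : List BStep → ℕ → Bool
isLeader B i with i <? length B
... | no _ = false
... | yes i< with lookup B (fromℕ< i<)
...   | (_ , u) = allᵇ (λ k → i ≤ᵇ index (iter (next B) (suc k) (i , emit u))) (upTo (length B + length B))

-- Number of light trajectories (= cycles of the boundary permutation):
-- each trajectory is counted at its least-indexed step.
cycleCount : List BStep → ℕ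
cycleCount B = length (filterᵇ (isLeader B) (upTo (length B)))

traj₂ : Path → Path → ℕ
traj₂ P Q = cycleCount (boundary P Q)

traj : ℕ → Path → ℕ
traj n P = traj₂ P (replicate n N ++ replicate n E)

Zstar : ℕ → Path
Zstar n = N ∷ concat (replicate (n ∸ 1) (N ∷ E ∷ [])) ++ E ∷ []

{-# OPTIONS --safe #-}
module Submission where

-- In doubled coordinates the boundary of the polygon of Z*_n (n = n′ + 1) consists of the first
-- step, the 2n′ steps of the staircase, the last step, and the n bottom and n right steps of
-- -(NⁿEⁿ).  Each beam runs along a diagonal, and following the beams shows that the boundary
-- splits into one 4-cycle through the first and the last step, a 4-cycle through stair steps
-- 2k+1 and 2k+2 when n = 2k+2, and for each k with 2k+3 ≤ n an 8-cycle through stair steps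
-- 2k+1, 2k+2, 2n-2k-3 and 2n-2k-2.  Counting every cycle at its least index, the leaders are
-- step 0 and the odd stair steps below n, so traj(Z*_n) = ⌊n/2⌋ + 1, whose parity only depends
-- on n mod 4.

open import Defs
open import Data.Nat using (ℕ; _≤_; _%_)
open import Data.Sum using (_⊎_)
open import Data.Product using (_×_)
open import Relation.Binary.PropositionalEquality using (_≡_)

open import Data.Bool using (Bool; true; false; _∧_; _∨_; T)
open import Data.Bool.Properties using (∧-zeroʳ)
open import Data.Empty using (⊥-elim)
open import Data.Fin using (fromℕ<)
open import Data.Integer as ℤ using (+_; -[1+_])
open import Data.List
  using (List; []; _∷_; _++_; length; lookup; applyUpTo; upTo; filterᵇ; map; replicate; concat)
open import Data.List.Membership.Propositional using (_∈_)
open import Data.List.Properties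
  using (map-++; map-replicate; map-applyUpTo; map-cong; ++-assoc; ++-identityʳ; length-++; length-applyUpTo)
open import Data.List.Relation.Unary.All as All using (All; []; _∷_)
open import Data.List.Relation.Unary.All.Properties using (applyUpTo⁺₁; applyUpTo⁺₂; ++⁺)
open import Data.List.Relation.Unary.Any using (here; there)
open import Data.Maybe as Maybe using (Maybe; just; nothing)
open import Data.Maybe.Properties using (just-injective; map-just; map-nothing)
open import Data.Nat as ℕ using (zero; suc; _+_; _<_; _≤ᵇ_; z≤n; s≤s; ⌊_/2⌋)
open import Data.Nat.Properties
open import Data.Nat.Tactic.RingSolver using (solve-∀)
open import Data.Product using (_,_; proj₁; proj₂; ∃-syntax)
open import Data.Product.Properties using (≡-dec)
open import Data.Sum using (inj₁; inj₂)
import Data.Sum as Sum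
open import Function using (_∘_)
open import Function.Definitions using (Injective)
open import Relation.Binary.Definitions using (tri<; tri≈; tri>)
open import Relation.Binary.PropositionalEquality
  using (refl; sym; trans; cong; cong₂; subst; _≢_; module ≡-Reasoning)
open import Relation.Nullary using (yes; no)

m+n≡o⇒m≤o : ∀ {m o} n → m + n ≡ o → m ≤ o
m+n≡o⇒m≤o {m} n refl = m≤m+n m n

double-< : ∀ {d k} → d < k → suc (d + d) < k + k
double-< {d} d< = ≤-trans (s≤s (≤-reflexive (sym (+-suc d d)))) (+-mono-≤ d< d<)

double-<⁻ : ∀ {d k} → d + d < k + k → d < k
double-<⁻ {d} {k} h with d <? k
... | yes d< = d<
... | no d≮  = ⊥-elim (<⇒≱ h (+-mono-≤ (≮⇒≥ d≮) (≮⇒≥ d≮)))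

double-injective : ∀ {j k} → j + j ≡ k + k → j ≡ k
double-injective {zero}  {zero}  _  = refl
double-injective {suc j} {suc k} eq =
  cong suc (double-injective (suc-injective (trans (sym (+-suc j j)) (trans (suc-injective eq) (+-suc k k)))))

double-shift : ∀ m x → m + m + (2 + x) ≡ suc m + suc m + x
double-shift = solve-∀

module _ {A : Set} where

  nth : List A → ℕ → Maybe A
  nth []       _       = nothing
  nth (x ∷ xs) zero    = just x
  nth (x ∷ xs) (suc i) = nth xs i

  nth-lookup : ∀ xs {i} (i< : i < length xs) → nth xs i ≡ just (lookup xs (fromℕ< i<))
  nth-lookup (x ∷ xs) {zero}  _        = refl
  nth-lookup (x ∷ xs) {suc i} (s≤s i<) = nth-lookup xs i<

  nth⇒< : ∀ xs {i x} → nth xs i ≡ just x → i < length xs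
  nth⇒< (_ ∷ xs) {zero}  _ = s≤s z≤n
  nth⇒< (_ ∷ xs) {suc i} h = s≤s (nth⇒< xs h)

  nth-++ˡ : ∀ xs {ys i x} → nth xs i ≡ just x → nth (xs ++ ys) i ≡ just x
  nth-++ˡ (_ ∷ xs) {i = zero}  h = h
  nth-++ˡ (_ ∷ xs) {i = suc i} h = nth-++ˡ xs h

  nth-++ʳ : ∀ xs {ys} i → nth (xs ++ ys) (length xs + i) ≡ nth ys i
  nth-++ʳ []       i = refl
  nth-++ʳ (_ ∷ xs) i = nth-++ʳ xs i

  nth-applyUpTo : ∀ f {k i} → i < k → nth (applyUpTo f k) i ≡ just (f i)
  nth-applyUpTo f {suc k} {zero}  _        = refl
  nth-applyUpTo f {suc k} {suc i} (s≤s i<) = nth-applyUpTo (f ∘ suc) i<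

  applyUpTo-cong : ∀ {f g : ℕ → A} → (∀ i → f i ≡ g i) → ∀ k → applyUpTo f k ≡ applyUpTo g k
  applyUpTo-cong f≗g zero    = refl
  applyUpTo-cong f≗g (suc k) = cong₂ _∷_ (f≗g 0) (applyUpTo-cong (f≗g ∘ suc) k)

mid : BStep → Pt
mid = proj₁

Avoids : Pt → List BStep → Set
Avoids p = All (λ b → p ≢ mid b)

indexOf-here : ∀ p b bs → p ≡ mid b → indexOf p (b ∷ bs) ≡ just 0
indexOf-here p (m , _) bs p≡m with ≡-dec ℤ._≟_ ℤ._≟_ p m
... | yes _   = refl
... | no p≢m = ⊥-elim (p≢m p≡m)

indexOf-there : ∀ p b bs → p ≢ mid b → indexOf p (b ∷ bs) ≡ Maybe.map suc (indexOf p bs)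
indexOf-there p (m , _) bs p≢m with ≡-dec ℤ._≟_ ℤ._≟_ p m
... | yes p≡m = ⊥-elim (p≢m p≡m)
... | no _ with indexOf p bs
...   | just _  = refl
...   | nothing = refl

indexOf-∷-just : ∀ p {i} b bs → p ≢ mid b → indexOf p bs ≡ just i → indexOf p (b ∷ bs) ≡ just (suc i)
indexOf-∷-just p b bs p≢b hit = trans (indexOf-there p b bs p≢b) (map-just hit)

indexOf-avoids : ∀ {p bs} → Avoids p bs → indexOf p bs ≡ nothing
indexOf-avoids {bs = []}     []          = refl
indexOf-avoids {p} {b ∷ bs} (p≢b ∷ avs) = trans (indexOf-there p b bs p≢b) (map-nothing (indexOf-avoids avs))

indexOf-++-avoids : ∀ {p i} xs ys → Avoids p xs → indexOf p ys ≡ just i →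
                    indexOf p (xs ++ ys) ≡ just (length xs + i)
indexOf-++-avoids      []       ys []          hit = hit
indexOf-++-avoids {p} (b ∷ xs) ys (p≢b ∷ avs) hit =
  indexOf-∷-just p b (xs ++ ys) p≢b (indexOf-++-avoids xs ys avs hit)

indexOf-applyUpTo-++ : ∀ g ys {k i} → Injective _≡_ _≡_ (mid ∘ g) → i < k →
                       indexOf (mid (g i)) (applyUpTo g k ++ ys) ≡ just i
indexOf-applyUpTo-++ g ys {suc k} {zero}  inj _        = indexOf-here (mid (g 0)) (g 0) _ refl
indexOf-applyUpTo-++ g ys {suc k} {suc i} inj (s≤s i<) =
  indexOf-∷-just (mid (g (suc i))) (g 0) (applyUpTo (g ∘ suc) k ++ ys) (λ eq → 0≢1+n (sym (inj eq)))
    (indexOf-applyUpTo-++ (g ∘ suc) ys (suc-injective ∘ inj) i<)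

-- Leaders of light cycles

next-≡ : ∀ B i d {m u j m′ u′} → nth B i ≡ just (m , u) → travel B (length B) m d ≡ just j →
         nth B j ≡ just (m′ , u′) → next B (i , d) ≡ (j , reflectAt u′ d)
next-≡ B i d {m} {u} {j} {m′} {u′} hi ht hj with i <? length B
... | no i≮ = ⊥-elim (i≮ (nth⇒< B hi))
... | yes i< with lookup B (fromℕ< i<) | just-injective (trans (sym (nth-lookup B i<)) hi)
...   | .(m , u) | refl with travel B (length B) m d | ht
...     | .(just j) | refl with j <? length B
...       | no j≮ = ⊥-elim (j≮ (nth⇒< B hj))
...       | yes j< with lookup B (fromℕ< j<) | just-injective (trans (sym (nth-lookup B j<)) hj)
...         | .(m′ , u′) | refl = refl

travel-arrive : ∀ B {fuel} p d {q j} → p ⊕ d ≡ q → indexOf q B ≡ just j → travel B (suc fuel) p d ≡ just j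
travel-arrive B p d refl hit with indexOf (p ⊕ d) B | hit
... | just _  | refl = refl
... | nothing | ()

travel-pass : ∀ B {fuel} p d {q j} → p ⊕ d ≡ q → indexOf q B ≡ nothing →
              travel B fuel q d ≡ just j → travel B (suc fuel) p d ≡ just j
travel-pass B p d refl miss onward with indexOf (p ⊕ d) B | miss
... | nothing | refl = onward
... | just _  | ()

allᵇ-true : ∀ p xs → (∀ x → T (p x)) → allᵇ p xs ≡ true
allᵇ-true p []       _  = refl
allᵇ-true p (x ∷ xs) px with p x | px x
... | true | _ = allᵇ-true p xs px

allᵇ-applyUpTo-false : ∀ p f {k m} → k < m → p (f k) ≡ false → allᵇ p (applyUpTo f m) ≡ false
allᵇ-applyUpTo-false p f {zero}  (s≤s _)  pk rewrite pk = refl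
allᵇ-applyUpTo-false p f {suc k} (s≤s k<) pk
  rewrite allᵇ-applyUpTo-false p (f ∘ suc) k< pk = ∧-zeroʳ (p (f 0))

isLeader-unfold : ∀ {B i m u} → nth B i ≡ just (m , u) →
  isLeader B i ≡ allᵇ (λ k → i ≤ᵇ index (iter (next B) (suc k) (i , emit u))) (upTo (length B + length B))
isLeader-unfold {B} {i} {m} {u} hi = via (next B) refl
  where
  -- With `next B` abstracted, the case split on `lookup B` below does not reach into it.
  via : ∀ nx → nx ≡ next B →
        isLeader B i ≡ allᵇ (λ k → i ≤ᵇ index (iter nx (suc k) (i , emit u))) (upTo (length B + length B))
  via nx nx≡ with i <? length B
  ... | no i≮ = ⊥-elim (i≮ (nth⇒< B hi))
  ... | yes i< with lookup B (fromℕ< i<) | just-injective (trans (sym (nth-lookup B i<)) hi)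
  ...   | .(m , u) | refl rewrite nx≡ = refl

leader : ∀ {B i m u} → nth B i ≡ just (m , u) →
         (∀ k → i ≤ index (iter (next B) k (i , emit u))) → isLeader B i ≡ true
leader {B} {i} {m} {u} hi bound = trans (isLeader-unfold {B} {i} {m} {u} hi)
  (allᵇ-true (λ k → i ≤ᵇ index (iter (next B) (suc k) (i , emit u))) (upTo (length B + length B))
             (λ k → ≤⇒≤ᵇ (bound (suc k))))

non-leader : ∀ {B i m u} k → nth B i ≡ just (m , u) → k < length B + length B →
             index (iter (next B) (suc k) (i , emit u)) < i → isLeader B i ≡ false
non-leader {B} {i} {m} {u} k hi k< below = trans (isLeader-unfold {B} {i} {m} {u} hi)
  (allᵇ-applyUpTo-false (λ k → i ≤ᵇ index (iter (next B) (suc k) (i , emit u))) (λ x → x) k< (≤ᵇ-false below))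
  where
  ≤ᵇ-false : ∀ {a b} → b < a → (a ≤ᵇ b) ≡ false
  ≤ᵇ-false {a} {b} b<a with a ≤ᵇ b in eq
  ... | false = refl
  ... | true  = ⊥-elim (<⇒≱ b<a (≤ᵇ⇒≤ a b (subst T (sym eq) _)))

infixr 5 _∷_

data Chain {A : Set} (f : A → A) (y : A) : List A → Set where
  [_] : ∀ {x} → f x ≡ y → Chain f y (x ∷ [])
  _∷_ : ∀ {x x′ xs} → f x ≡ x′ → Chain f y (x′ ∷ xs) → Chain f y (x ∷ x′ ∷ xs)

module _ {A : Set} {f : A → A} where

  chain-reaches : ∀ {y xs x} → Chain f y xs → x ∈ xs → ∃[ k ] k < length xs × iter f (suc k) x ≡ y
  chain-reaches [ fx≡y ]    (here refl) = 0 , s≤s z≤n , fx≡y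
  chain-reaches (fx≡x′ ∷ c) (here refl) with chain-reaches c (here refl)
  ... | k , k< , reach = suc k , s≤s k< , trans (cong (iter f (suc k)) fx≡x′) reach
  chain-reaches (_ ∷ c)     (there x∈) with chain-reaches c x∈
  ... | k , k< , reach = k , m≤n⇒m≤1+n k< , reach

  chain-closed : ∀ {y xs x} → Chain f y xs → x ∈ xs → f x ≡ y ⊎ f x ∈ xs
  chain-closed [ fx≡y ]    (here refl) = inj₁ fx≡y
  chain-closed (fx≡x′ ∷ c) (here refl) = inj₂ (there (here fx≡x′))
  chain-closed (_ ∷ c)     (there x∈)  = Sum.map₂ there (chain-closed c x∈)

  cycle-iter : ∀ {x₀ xs x} → Chain f x₀ (x₀ ∷ xs) → x ∈ x₀ ∷ xs → ∀ k → iter f k x ∈ x₀ ∷ xs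
  cycle-iter c x∈ zero    = x∈
  cycle-iter c x∈ (suc k) with chain-closed c x∈
  ... | inj₁ fx≡x₀ = cycle-iter c (here fx≡x₀) k
  ... | inj₂ fx∈   = cycle-iter c fx∈ k

leader-on-cycle : ∀ B i {m u x₀ xs} → Chain (next B) x₀ (x₀ ∷ xs) → nth B i ≡ just (m , u) →
                  (i , emit u) ∈ x₀ ∷ xs → All (λ s → i ≤ index s) (x₀ ∷ xs) → isLeader B i ≡ true
leader-on-cycle B i {m} {u} c hi start bounds =
  leader {B} {i} {m} {u} hi (λ k → All.lookup bounds (cycle-iter c start k))

non-leader-on-cycle : ∀ B i {m u x₀ xs} → Chain (next B) x₀ (x₀ ∷ xs) → length xs < length B + length B →
                      nth B i ≡ just (m , u) → (i , emit u) ∈ x₀ ∷ xs → index x₀ < i → isLeader B i ≡ false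
non-leader-on-cycle B i {m} {u} c short hi start x₀< with chain-reaches c start
... | k , k< , reach =
  non-leader {B} {i} {m} {u} k hi (<-≤-trans k< short) (subst (λ s → index s < i) (sym reach) x₀<)

pt : ℕ → ℕ → Pt
pt a b = (+ a , + b)

pt-injective : ∀ {a b c d} → pt a b ≡ pt c d → a ≡ c × b ≡ d
pt-injective refl = refl , refl

north east south west ↗ ↘ ↖ ↙ : Pt
north = (+ 0 , + 1)
east  = (+ 1 , + 0)
south = (+ 0 , -[1+ 0 ])
west  = (-[1+ 0 ] , + 0)
↗ = (+ 1 , + 1)
↘ = (+ 1 , -[1+ 0 ])
↖ = (-[1+ 0 ] , + 1)
↙ = (-[1+ 0 ] , -[1+ 0 ])

+1≡suc : ∀ x → + x ℤ.+ + 1 ≡ + suc x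
+1≡suc x = cong +_ (+-comm x 1)

↗-step : ∀ x y → pt x y ⊕ ↗ ≡ pt (suc x) (suc y)
↗-step x y = cong₂ _,_ (+1≡suc x) (+1≡suc y)

↘-step : ∀ x y → pt x (suc y) ⊕ ↘ ≡ pt (suc x) y
↘-step x y = cong (_, + y) (+1≡suc x)

↖-step : ∀ x y → pt (suc x) y ⊕ ↖ ≡ pt x (suc y)
↖-step x y = cong (+ x ,_) (+1≡suc y)

↙-step : ∀ x y → pt (suc x) (suc y) ⊕ ↙ ≡ pt x y
↙-step x y = refl

walk-N : ∀ x y ss → walk (pt x y) (N ∷ ss) ≡ (pt x (suc y) , north) ∷ walk (pt x (2 + y)) ss
walk-N x y ss rewrite +-identityʳ x | +-comm y 1 | +-comm y 2 = refl

walk-E : ∀ x y ss → walk (pt x y) (E ∷ ss) ≡ (pt (suc x) y , east) ∷ walk (pt (2 + x) y) ss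
walk-E x y ss rewrite +-identityʳ y | +-comm x 1 | +-comm x 2 = refl

stairDir : ℕ → Pt
stairDir zero          = north
stairDir (suc zero)    = east
stairDir (suc (suc a)) = stairDir a

stairDir-even : ∀ d → stairDir (d + d) ≡ north
stairDir-even zero    = refl
stairDir-even (suc d) rewrite +-suc d d = stairDir-even d

stairDir-odd : ∀ d → stairDir (suc (d + d)) ≡ east
stairDir-odd zero    = refl
stairDir-odd (suc d) rewrite +-suc d d = stairDir-odd d

walk-stairs : ∀ m x ys →
  walk (pt x (2 + x)) (concat (replicate m (N ∷ E ∷ [])) ++ ys) ≡
  applyUpTo (λ a → (pt (a + x) (3 + (a + x)) , stairDir a)) (m + m) ++ walk (pt (m + m + x) (2 + (m + m + x))) ys
walk-stairs zero    x ys = refl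
walk-stairs (suc m) x ys = begin
  walk (pt x (2 + x)) (N ∷ E ∷ rest)
    ≡⟨ walk-N x (2 + x) (E ∷ rest) ⟩
  g 0 ∷ walk (pt x (4 + x)) (E ∷ rest)
    ≡⟨ cong (g 0 ∷_) (walk-E x (4 + x) rest) ⟩
  g 0 ∷ g 1 ∷ walk (pt (2 + x) (4 + x)) rest
    ≡⟨ cong (λ r → g 0 ∷ g 1 ∷ r) (walk-stairs m (2 + x) ys) ⟩
  g 0 ∷ g 1 ∷ applyUpTo (λ a → (pt (a + (2 + x)) (3 + (a + (2 + x))) , stairDir a)) (m + m) ++
              walk (pt (m + m + (2 + x)) (2 + (m + m + (2 + x)))) ys
    ≡⟨ cong (λ r → g 0 ∷ g 1 ∷ r)
            (cong₂ _++_ (applyUpTo-cong (λ a → cong (λ z → (pt z (3 + z) , stairDir a)) (shift a)) (m + m))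
                        (cong (λ z → walk (pt z (2 + z)) ys) (double-shift m x))) ⟩
  applyUpTo g (2 + (m + m)) ++ after
    ≡⟨ cong (λ k → applyUpTo g (suc k) ++ after) (sym (+-suc m m)) ⟩
  applyUpTo g (suc m + suc m) ++ after ∎
  where
  open ≡-Reasoning
  rest : Path
  rest = concat (replicate m (N ∷ E ∷ [])) ++ ys
  after : List BStep
  after = walk (pt (suc m + suc m + x) (2 + (suc m + suc m + x))) ys
  g : ℕ → BStep
  g a = (pt (a + x) (3 + (a + x)) , stairDir a)
  shift : ∀ a → a + (2 + x) ≡ 2 + a + x
  shift a = trans (+-suc a (suc x)) (cong suc (+-suc a x))

walk-east : ∀ m x ys →
  walk (pt x 0) (replicate m E ++ ys) ≡ applyUpTo (λ j → (pt (suc (j + j) + x) 0 , east)) m ++ walk (pt (m + m + x) 0) ys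
walk-east zero    x ys = refl
walk-east (suc m) x ys = trans (walk-E x 0 (replicate m E ++ ys)) (cong ((pt (suc x) 0 , east) ∷_)
  (trans (walk-east m (2 + x) ys)
         (cong₂ _++_ (applyUpTo-cong (λ j → cong (λ z → (pt z 0 , east)) (cong suc (double-shift j x))) m)
                     (cong (λ z → walk (pt z 0) ys) (double-shift m x)))))

walk-north : ∀ m x y → walk (pt x y) (replicate m N) ≡ applyUpTo (λ j → (pt x (suc (j + j) + y) , north)) m
walk-north zero    x y = refl
walk-north (suc m) x y = trans (walk-N x y (replicate m N)) (cong ((pt x (suc y) , north) ∷_)
  (trans (walk-north m x (2 + y))
         (applyUpTo-cong (λ j → cong (λ z → (pt x z , north)) (cong suc (double-shift j y))) m)))

negB : BStep → BStep
negB (m , (a , b)) = (m , (ℤ.- a , ℤ.- b))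

-- The polygon of Z*_n

module Polygon (n′ : ℕ) where

  n : ℕ
  n = suc n′

  B : List BStep
  B = boundary (Zstar n) (replicate n N ++ replicate n E)

  firstStep lastStep : BStep
  firstStep = (pt 0 1 , north)
  lastStep  = (pt (suc (n′ + n′)) (2 + (n′ + n′)) , east)

  stairStep bottomStep rightStep : ℕ → BStep
  stairStep  a = (pt a (3 + a) , stairDir a)
  bottomStep m = (pt (suc (m + m)) 0 , west)
  rightStep  d = (pt (n + n) (suc (d + d)) , south)

  stairs bottoms rights lowerSteps : List BStep
  stairs     = applyUpTo stairStep (n′ + n′)
  bottoms    = applyUpTo bottomStep n
  rights     = applyUpTo rightStep n
  lowerSteps = bottoms ++ rights

  length-stairs : length stairs ≡ n′ + n′
  length-stairs = length-applyUpTo stairStep (n′ + n′)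

  2+2n′≡n+n : 2 + (n′ + n′) ≡ n + n
  2+2n′≡n+n = cong suc (sym (+-suc n′ n′))

  B-shape : B ≡ firstStep ∷ stairs ++ lastStep ∷ lowerSteps
  B-shape = begin
    B
      ≡⟨ cong (walk (pt 0 0) (Zstar n) ++_) (map-cong (λ { (m , (a , b)) → refl }) lowerWalk) ⟩
    walk (pt 0 0) (Zstar n) ++ map negB lowerWalk
      ≡⟨ cong₂ _++_ upper lower ⟩
    (firstStep ∷ stairs ++ lastStep ∷ []) ++ lowerSteps
      ≡⟨ cong (firstStep ∷_) (++-assoc stairs (lastStep ∷ []) lowerSteps) ⟩
    firstStep ∷ stairs ++ lastStep ∷ lowerSteps ∎
    where
    open ≡-Reasoning
    lowerWalk : List BStep
    lowerWalk = walk (pt 0 0) (map refl-step (replicate n N ++ replicate n E))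
    upper : walk (pt 0 0) (Zstar n) ≡ firstStep ∷ stairs ++ lastStep ∷ []
    upper = cong (firstStep ∷_) (trans (walk-stairs n′ 0 (E ∷ []))
      (cong₂ _++_ (applyUpTo-cong (λ a → cong (λ z → (pt z (3 + z) , stairDir a)) (+-identityʳ a)) (n′ + n′))
                  (trans (cong (λ z → walk (pt z (2 + z)) (E ∷ [])) (+-identityʳ (n′ + n′)))
                         (walk-E (n′ + n′) (2 + (n′ + n′)) []))))
    eastStep northStep : ℕ → BStep
    eastStep  j = (pt (suc (j + j) + 0) 0 , east)
    northStep j = (pt (n + n + 0) (suc (j + j) + 0) , north)
    lower : map negB lowerWalk ≡ lowerSteps
    lower = begin
      map negB lowerWalk
        ≡⟨ cong (map negB ∘ walk (pt 0 0))
                (trans (map-++ refl-step (replicate n N) (replicate n E))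
                       (cong₂ _++_ (map-replicate refl-step n N) (map-replicate refl-step n E))) ⟩
      map negB (walk (pt 0 0) (replicate n E ++ replicate n N))
        ≡⟨ cong (map negB) (trans (walk-east n 0 (replicate n N))
                                  (cong (applyUpTo eastStep n ++_) (walk-north n (n + n + 0) 0))) ⟩
      map negB (applyUpTo eastStep n ++ applyUpTo northStep n)
        ≡⟨ trans (map-++ negB (applyUpTo eastStep n) (applyUpTo northStep n))
                 (cong₂ _++_ (map-applyUpTo eastStep negB n) (map-applyUpTo northStep negB n)) ⟩
      applyUpTo (negB ∘ eastStep) n ++ applyUpTo (negB ∘ northStep) n
        ≡⟨ cong₂ _++_
             (applyUpTo-cong (λ j → cong (λ z → (pt (suc z) 0 , west)) (+-identityʳ (j + j))) n)
             (applyUpTo-cong (λ j → cong₂ (λ z w → (pt z (suc w) , south))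
                                          (+-identityʳ (n + n)) (+-identityʳ (j + j))) n) ⟩
      lowerSteps ∎

  length-B : length B ≡ n + n + n + n
  length-B = begin
    length B                                                  ≡⟨ cong length B-shape ⟩
    suc (length (stairs ++ lastStep ∷ lowerSteps))            ≡⟨ cong suc (length-++ stairs) ⟩
    suc (length stairs + suc (length lowerSteps))             ≡⟨ cong₂ (λ l l′ → suc (l + suc l′)) length-stairs
                                                                   (length-++ bottoms) ⟩
    suc (n′ + n′ + suc (length bottoms + length rights))      ≡⟨ cong₂ (λ l l′ → suc (n′ + n′ + suc (l + l′)))
                                                                   (length-applyUpTo bottomStep n)
                                                                   (length-applyUpTo rightStep n) ⟩
    suc (n′ + n′ + suc (n + n))                               ≡⟨ four n′ ⟩
    n + n + n + n ∎
    where
    open ≡-Reasoning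
    four : ∀ k → suc (k + k + suc (suc k + suc k)) ≡ suc k + suc k + suc k + suc k
    four = solve-∀

  nth-first : nth B 0 ≡ just firstStep
  nth-first = cong (λ xs → nth xs 0) B-shape

  nth-stair : ∀ {a} → a < n′ + n′ → nth B (suc a) ≡ just (stairStep a)
  nth-stair {a} a< = trans (cong (λ xs → nth xs (suc a)) B-shape)
    (nth-++ˡ stairs {lastStep ∷ lowerSteps} {a} (nth-applyUpTo stairStep a<))

  nth-stairN : ∀ {d} → d < n′ → nth B (suc (d + d)) ≡ just (pt (d + d) (3 + (d + d)) , north)
  nth-stairN {d} d< = trans (nth-stair (<-trans (n<1+n (d + d)) (double-< d<)))
    (cong (λ u → just (pt (d + d) (3 + (d + d)) , u)) (stairDir-even d))

  nth-stairE : ∀ {d} → d < n′ → nth B (2 + (d + d)) ≡ just (pt (suc (d + d)) (4 + (d + d)) , east)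
  nth-stairE {d} d< = trans (nth-stair (double-< d<))
    (cong (λ u → just (pt (suc (d + d)) (4 + (d + d)) , u)) (stairDir-odd d))

  nth-last : nth B (suc (n′ + n′)) ≡ just lastStep
  nth-last = begin
    nth B (suc (n′ + n′))                                     ≡⟨ cong (λ xs → nth xs (suc (n′ + n′))) B-shape ⟩
    nth (stairs ++ lastStep ∷ lowerSteps) (n′ + n′)           ≡⟨ cong (nth (stairs ++ lastStep ∷ lowerSteps))
                                                                   (sym (trans (+-identityʳ _) length-stairs)) ⟩
    nth (stairs ++ lastStep ∷ lowerSteps) (length stairs + 0) ≡⟨ nth-++ʳ stairs 0 ⟩
    just lastStep ∎
    where open ≡-Reasoning

  nth-lower : ∀ j → nth B (n + n + j) ≡ nth lowerSteps j
  nth-lower j = begin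
    nth B (n + n + j)                                          ≡⟨ cong (λ xs → nth xs (n + n + j)) B-shape ⟩
    nth (stairs ++ lastStep ∷ lowerSteps) (n′ + suc n′ + j)    ≡⟨ cong (nth (stairs ++ lastStep ∷ lowerSteps))
                                                                    (trans (past-stairs n′ j)
                                                                           (cong (_+ suc j) (sym length-stairs))) ⟩
    nth (stairs ++ lastStep ∷ lowerSteps) (length stairs + suc j) ≡⟨ nth-++ʳ stairs (suc j) ⟩
    nth lowerSteps j ∎
    where
    open ≡-Reasoning
    past-stairs : ∀ k j → k + suc k + j ≡ k + k + suc j
    past-stairs = solve-∀

  nth-bottom : ∀ {m} → m < n → nth B (n + n + m) ≡ just (bottomStep m)
  nth-bottom {m} m< = trans (nth-lower m) (nth-++ˡ bottoms {rights} {m} (nth-applyUpTo bottomStep m<))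

  nth-right : ∀ {d} → d < n → nth B (n + n + n + d) ≡ just (rightStep d)
  nth-right {d} d< = begin
    nth B (n + n + n + d)                   ≡⟨ cong (nth B) (+-assoc (n + n) n d) ⟩
    nth B (n + n + (n + d))                 ≡⟨ nth-lower (n + d) ⟩
    nth lowerSteps (n + d)                  ≡⟨ cong (λ l → nth lowerSteps (l + d)) (sym (length-applyUpTo bottomStep n)) ⟩
    nth lowerSteps (length bottoms + d)     ≡⟨ nth-++ʳ bottoms d ⟩
    nth rights d                            ≡⟨ nth-applyUpTo rightStep d< ⟩
    just (rightStep d) ∎
    where open ≡-Reasoning

  record Inside (a b : ℕ) : Set where
    field
      0<a   : 0 < a
      0<b   : 0 < b
      b≤1+a : b ≤ suc a
      a<2n  : a < n + n
      b<2n  : b < n + n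

  stairs-avoid : ∀ {a b} → b < 3 + a → Avoids (pt a b) stairs
  stairs-avoid b< = applyUpTo⁺₂ stairStep (n′ + n′) λ j eq →
    <⇒≢ b< (trans (proj₂ (pt-injective eq)) (cong (λ z → 3 + z) (sym (proj₁ (pt-injective eq)))))

  bottoms-avoid : ∀ {a b} → 0 < b → Avoids (pt a b) bottoms
  bottoms-avoid 0<b = applyUpTo⁺₂ bottomStep n λ j eq → <⇒≢ 0<b (sym (proj₂ (pt-injective eq)))

  rights-avoid : ∀ {a b} → a < n + n → Avoids (pt a b) rights
  rights-avoid a< = applyUpTo⁺₂ rightStep n λ j eq → <⇒≢ a< (proj₁ (pt-injective eq))

  indexOf-inside : ∀ {a b} → Inside a b → indexOf (pt a b) B ≡ nothing
  indexOf-inside {a} {b} ins = trans (cong (indexOf (pt a b)) B-shape)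
    (indexOf-avoids {pt a b} {firstStep ∷ stairs ++ lastStep ∷ lowerSteps}
      ((λ eq → <⇒≢ 0<a (sym (proj₁ (pt-injective eq))))
       ∷ ++⁺ (stairs-avoid (≤-trans (s≤s b≤1+a) (n≤1+n _)))
             ((λ eq → <⇒≢ b<2n (trans (proj₂ (pt-injective eq)) 2+2n′≡n+n))
              ∷ ++⁺ (bottoms-avoid 0<b) (rights-avoid a<2n))))
    where open Inside ins

  indexOf-first : indexOf (pt 0 1) B ≡ just 0
  indexOf-first = trans (cong (indexOf (pt 0 1)) B-shape)
    (indexOf-here (pt 0 1) firstStep (stairs ++ lastStep ∷ lowerSteps) refl)

  indexOf-stair : ∀ {a} → a < n′ + n′ → indexOf (pt a (3 + a)) B ≡ just (suc a)
  indexOf-stair {a} a< = trans (cong (indexOf (pt a (3 + a))) B-shape)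
    (indexOf-∷-just (pt a (3 + a)) firstStep (stairs ++ lastStep ∷ lowerSteps) (λ ())
      (indexOf-applyUpTo-++ stairStep (lastStep ∷ lowerSteps) (proj₁ ∘ pt-injective) a<))

  indexOf-last : indexOf (mid lastStep) B ≡ just (suc (n′ + n′))
  indexOf-last = trans (cong (indexOf (mid lastStep)) B-shape)
    (indexOf-∷-just (mid lastStep) firstStep (stairs ++ lastStep ∷ lowerSteps) (λ ())
      (trans (indexOf-++-avoids stairs (lastStep ∷ lowerSteps) (stairs-avoid (≤-trans (n<1+n _) (n≤1+n _)))
                                (indexOf-here (mid lastStep) lastStep lowerSteps refl))
             (cong just (trans (+-identityʳ (length stairs)) length-stairs))))

  indexOf-lower : ∀ a b {j} → 0 < a → b < 3 + a → b < n + n → indexOf (pt a b) lowerSteps ≡ just j →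
                  indexOf (pt a b) B ≡ just (n + n + j)
  indexOf-lower a b {j} 0<a b<3+a b<2n hit = trans (cong (indexOf (pt a b)) B-shape)
    (indexOf-∷-just (pt a b) firstStep (stairs ++ lastStep ∷ lowerSteps)
                    (λ eq → <⇒≢ 0<a (sym (proj₁ (pt-injective eq))))
      (trans (indexOf-++-avoids stairs (lastStep ∷ lowerSteps) (stairs-avoid b<3+a)
               (indexOf-∷-just (pt a b) lastStep lowerSteps
                  (λ eq → <⇒≢ b<2n (trans (proj₂ (pt-injective eq)) 2+2n′≡n+n)) hit))
             (cong just (trans (cong (_+ suc j) length-stairs) (past-stairs n′ j)))))
    where
    past-stairs : ∀ k j → k + k + suc j ≡ k + suc k + j
    past-stairs = solve-∀

  indexOf-bottom : ∀ {m} → m < n → indexOf (pt (suc (m + m)) 0) B ≡ just (n + n + m)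
  indexOf-bottom {m} m< = indexOf-lower (suc (m + m)) 0 (s≤s z≤n) (s≤s z≤n) (s≤s z≤n)
    (indexOf-applyUpTo-++ bottomStep rights (double-injective ∘ suc-injective ∘ proj₁ ∘ pt-injective) m<)

  indexOf-right : ∀ {d} → d < n → indexOf (pt (n + n) (suc (d + d))) B ≡ just (n + n + n + d)
  indexOf-right {d} d< = trans
    (indexOf-lower (n + n) (suc (d + d)) (s≤s z≤n) (<-≤-trans (double-< d<) (m≤n+m (n + n) 3)) (double-< d<)
      (indexOf-++-avoids bottoms rights (bottoms-avoid {n + n} (s≤s z≤n))
        (subst (λ xs → indexOf (pt (n + n) (suc (d + d))) xs ≡ just d) (++-identityʳ rights)
          (indexOf-applyUpTo-++ rightStep [] (double-injective ∘ suc-injective ∘ proj₂ ∘ pt-injective) d<))))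
    (cong just (trans (cong (λ l → n + n + (l + d)) (length-applyUpTo bottomStep n)) (sym (+-assoc (n + n) n d))))

  fuel-bound : ∀ {f x} → suc f + x ≤ n + n → f < length B
  fuel-bound {f} {x} h =
    ≤-trans (m≤m+n (suc f) x)
      (≤-trans h (≤-trans (m≤m+n (n + n) n) (≤-trans (m≤m+n (n + n + n) n) (≤-reflexive (sym length-B)))))

  private
    +-suc-≤ : ∀ {f x k} → suc (suc f) + x ≤ k → suc f + suc x ≤ k
    +-suc-≤ {f} {x} {k} = subst (_≤ k) (sym (+-suc (suc f) x))

  travel-adjacent : ∀ p d {q j} → p ⊕ d ≡ q → indexOf q B ≡ just j → travel B (length B) p d ≡ just j
  travel-adjacent = travel-arrive B

  -- A beam of suc f diagonal moves from p to q; the inequalities keep all points in between Inside.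

  travel-↗ : ∀ f x y p q {j} → p ≡ pt x y → q ≡ pt (suc f + x) (suc f + y) →
             y ≤ suc x → suc f + x ≤ n + n → suc f + y ≤ n + n →
             indexOf q B ≡ just j → travel B (length B) p ↗ ≡ just j
  travel-↗ f x y _ _ refl refl y≤ hx hy hit = go f x y (fuel-bound hx) y≤ hx hy hit
    where
    go : ∀ f x y {j fuel} → f < fuel → y ≤ suc x → suc f + x ≤ n + n → suc f + y ≤ n + n →
         indexOf (pt (suc f + x) (suc f + y)) B ≡ just j → travel B fuel (pt x y) ↗ ≡ just j
    go zero    x y {fuel = suc _} _ _ _ _ hit = travel-arrive B (pt x y) ↗ (↗-step x y) hit
    go (suc f) x y {j} {suc _} (s≤s f<) y≤ hx hy hit =
      travel-pass B (pt x y) ↗ (↗-step x y)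
        (indexOf-inside record { 0<a = s≤s z≤n ; 0<b = s≤s z≤n ; b≤1+a = s≤s y≤
                               ; a<2n = ≤-trans (s≤s (s≤s (m≤n+m x f))) hx
                               ; b<2n = ≤-trans (s≤s (s≤s (m≤n+m y f))) hy })
        (go f (suc x) (suc y) f< (s≤s y≤) (+-suc-≤ hx) (+-suc-≤ hy)
          (subst (λ p → indexOf p B ≡ just j) (sym (cong₂ pt (+-suc (suc f) x) (+-suc (suc f) y))) hit))

  travel-↙ : ∀ f x y p q {j} → p ≡ pt (suc f + x) (suc f + y) → q ≡ pt x y →
             y ≤ suc x → suc f + x ≤ n + n → suc f + y ≤ n + n →
             indexOf q B ≡ just j → travel B (length B) p ↙ ≡ just j
  travel-↙ f x y _ _ refl refl y≤ hx hy hit = go f (fuel-bound hx) hx hy hit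
    where
    go : ∀ f {j fuel} → f < fuel → suc f + x ≤ n + n → suc f + y ≤ n + n →
         indexOf (pt x y) B ≡ just j → travel B fuel (pt (suc f + x) (suc f + y)) ↙ ≡ just j
    go zero    {fuel = suc _} _ _ _ hit = travel-arrive B (pt (suc x) (suc y)) ↙ (↙-step x y) hit
    go (suc f) {fuel = suc _} (s≤s f<) hx hy hit =
      travel-pass B (pt (suc (suc f + x)) (suc (suc f + y))) ↙ (↙-step (suc f + x) (suc f + y))
        (indexOf-inside record { 0<a = s≤s z≤n ; 0<b = s≤s z≤n
                               ; b≤1+a = subst (suc f + y ≤_) (+-suc (suc f) x) (+-monoʳ-≤ (suc f) y≤)
                               ; a<2n = hx ; b<2n = hy })
        (go f f< (<⇒≤ hx) (<⇒≤ hy) hit)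

  travel-↘ : ∀ f x y p q {j} → p ≡ pt x (suc f + y) → q ≡ pt (suc f + x) y →
             suc f + y ≤ 3 + x → suc f + x ≤ n + n → suc f + y ≤ n + n →
             indexOf q B ≡ just j → travel B (length B) p ↘ ≡ just j
  travel-↘ f x y _ _ refl refl hb hx hy hit = go f x (fuel-bound hx) hb hx hy hit
    where
    go : ∀ f x {j fuel} → f < fuel → suc f + y ≤ 3 + x → suc f + x ≤ n + n → suc f + y ≤ n + n →
         indexOf (pt (suc f + x) y) B ≡ just j → travel B fuel (pt x (suc f + y)) ↘ ≡ just j
    go zero    x {fuel = suc _} _ _ _ _ hit = travel-arrive B (pt x (suc y)) ↘ (↘-step x y) hit
    go (suc f) x {j} {suc _} (s≤s f<) hb hx hy hit =
      travel-pass B (pt x (suc (suc f + y))) ↘ (↘-step x (suc f + y))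
        (indexOf-inside record { 0<a = s≤s z≤n ; 0<b = s≤s z≤n ; b≤1+a = ≤-pred hb
                               ; a<2n = ≤-trans (s≤s (s≤s (m≤n+m x f))) hx ; b<2n = hy })
        (go f (suc x) f< (≤-trans (n≤1+n _) (≤-trans hb (n≤1+n _))) (+-suc-≤ hx) (<⇒≤ hy)
          (subst (λ p → indexOf p B ≡ just j) (sym (cong (λ z → pt z y) (+-suc (suc f) x))) hit))

  travel-↖ : ∀ f x y p q {j} → p ≡ pt (suc f + x) y → q ≡ pt x (suc f + y) →
             suc f + y ≤ 3 + x → suc f + x ≤ n + n → suc f + y ≤ n + n →
             indexOf q B ≡ just j → travel B (length B) p ↖ ≡ just j
  travel-↖ f x y _ _ refl refl hb hx hy hit = go f y (fuel-bound hx) hb hx hy hit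
    where
    go : ∀ f y {j fuel} → f < fuel → suc f + y ≤ 3 + x → suc f + x ≤ n + n → suc f + y ≤ n + n →
         indexOf (pt x (suc f + y)) B ≡ just j → travel B fuel (pt (suc f + x) y) ↖ ≡ just j
    go zero    y {fuel = suc _} _ _ _ _ hit = travel-arrive B (pt (suc x) y) ↖ (↖-step x y) hit
    go (suc f) y {j} {suc _} (s≤s f<) hb hx hy hit =
      travel-pass B (pt (suc (suc f + x)) y) ↖ (↖-step (suc f + x) y)
        (indexOf-inside record { 0<a = s≤s z≤n ; 0<b = s≤s z≤n
                               ; b≤1+a = s≤s (≤-trans (m≤n+m y f)
                                                      (≤-trans (≤-pred (≤-pred hb)) (s≤s (m≤n+m x f))))
                               ; a<2n = hx ; b<2n = ≤-trans (s≤s (s≤s (m≤n+m y f))) hy })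
        (go f (suc y) f< (+-suc-≤ hb) (<⇒≤ hx) (+-suc-≤ hy)
          (subst (λ p → indexOf p B ≡ just j) (sym (cong (pt x) (+-suc (suc f) y))) hit))

  first-↗ : next B (0 , ↗) ≡ (suc (n′ + n′) , ↘)
  first-↗ = next-≡ B 0 ↗ nth-first
    (travel-↗ (n′ + n′) 0 1 (pt 0 1) (mid lastStep) refl
      (cong₂ pt (sym (+-identityʳ _)) (sym (+-comm (suc (n′ + n′)) 1))) (s≤s z≤n)
      (≤-trans (≤-reflexive (+-identityʳ _)) (≤-trans (n≤1+n _) (≤-reflexive 2+2n′≡n+n)))
      (≤-reflexive (trans (+-comm (suc (n′ + n′)) 1) 2+2n′≡n+n))
      indexOf-last)
    nth-last

  last-↘ : next B (suc (n′ + n′) , ↘) ≡ (n + n + n + n′ , ↙)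
  last-↘ = next-≡ B (suc (n′ + n′)) ↘ nth-last
    (travel-adjacent (mid lastStep) ↘
      (trans (↘-step (suc (n′ + n′)) (suc (n′ + n′))) (cong (λ z → pt z (suc (n′ + n′))) 2+2n′≡n+n))
      (indexOf-right ≤-refl))
    (nth-right ≤-refl)

  stairN-↗ : ∀ {d} → d < n′ → next B (suc (d + d) , ↗) ≡ (2 + (d + d) , ↘)
  stairN-↗ {d} d< = next-≡ B (suc (d + d)) ↗ (nth-stairN d<)
    (travel-adjacent (pt (d + d) (3 + (d + d))) ↗ (↗-step (d + d) (3 + (d + d))) (indexOf-stair (double-< d<)))
    (nth-stairE d<)

  stairE-↘-bottom : ∀ {d} → 2 + (d + d) < n → next B (2 + (d + d) , ↘) ≡ (n + n + (2 + (d + d)) , ↗)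
  stairE-↘-bottom {d} h = next-≡ B (2 + (d + d)) ↘ (nth-stairE d<)
    (travel-↘ (3 + (d + d)) (suc (d + d)) 0 (pt (suc (d + d)) (4 + (d + d))) (pt (suc (m + m)) 0)
      (cong (pt (suc (d + d))) (sym (+-identityʳ _))) (cong (λ z → pt z 0) (meet d))
      (≤-reflexive (+-identityʳ _)) hx (≤-trans (+-monoʳ-≤ (4 + (d + d)) z≤n) hx)
      (indexOf-bottom h))
    (nth-bottom h)
    where
    m : ℕ
    m = 2 + (d + d)
    d< : d < n′
    d< = ≤-trans (s≤s (m≤m+n d d)) (≤-trans (n≤1+n _) (≤-pred h))
    meet : ∀ d → suc ((2 + (d + d)) + (2 + (d + d))) ≡ 4 + (d + d) + suc (d + d)
    meet = solve-∀
    hx : 4 + (d + d) + suc (d + d) ≤ n + n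
    hx = ≤-trans (m+n≡o⇒m≤o 1 (spread d)) (+-mono-≤ h h)
      where spread : ∀ d → 4 + (d + d) + suc (d + d) + 1 ≡ 3 + (d + d) + (3 + (d + d))
            spread = solve-∀

  stairE-↘-right : ∀ {d r} → d < n′ → n + r ≡ 2 + (d + d) → next B (2 + (d + d) , ↘) ≡ (n + n + n + r , ↙)
  stairE-↘-right {d} {r} d< n+r with m≤n⇒∃[o]m+o≡n d<
  ... | s , d+s = next-≡ B (2 + (d + d)) ↘ (nth-stairE d<)
    (travel-↘ (2 + (s + s)) (suc (d + d)) (suc (r + r)) (pt (suc (d + d)) (4 + (d + d))) (pt (n + n) (suc (r + r)))
      (cong (pt (suc (d + d))) start) (cong (λ z → pt z (suc (r + r))) end)
      (≤-reflexive (sym start)) (≤-reflexive (sym end))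
      (≤-trans (≤-reflexive (sym start)) (≤-trans (m≤m+n (4 + (d + d)) (s + s)) (≤-reflexive (sym end′))))
      (indexOf-right r<))
    (nth-right r<)
    where
    n≡ : n ≡ 2 + (d + s)
    n≡ = cong suc (sym d+s)
    d≡ : d ≡ s + r
    d≡ = sym (+-cancelˡ-≡ (2 + d) (s + r) d (trans (regroup d s r) (trans (cong (_+ r) (sym n≡)) n+r)))
      where regroup : ∀ d s r → 2 + d + (s + r) ≡ 2 + (d + s) + r
            regroup = solve-∀
    start : 4 + (d + d) ≡ 3 + (s + s) + suc (r + r)
    start = trans (cong (λ z → 4 + (z + z)) d≡) (spread s r)
      where spread : ∀ s r → 4 + ((s + r) + (s + r)) ≡ 3 + (s + s) + suc (r + r)
            spread = solve-∀
    end′ : n + n ≡ 4 + (d + d) + (s + s)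
    end′ = trans (cong₂ _+_ n≡ n≡) (spread d s)
      where spread : ∀ d s → 2 + (d + s) + (2 + (d + s)) ≡ 4 + (d + d) + (s + s)
            spread = solve-∀
    end : n + n ≡ 3 + (s + s) + suc (d + d)
    end = trans end′ (swap d s)
      where swap : ∀ d s → 4 + (d + d) + (s + s) ≡ 3 + (s + s) + suc (d + d)
            swap = solve-∀
    r< : r < n
    r< = ≤-trans (s≤s (≤-trans (m≤n+m r s) (≤-reflexive (sym d≡)))) (≤-trans d< (n≤1+n n′))

  private
    corner : ∀ m d → suc (m + d) ≡ n → pt (n + n) (suc (d + d)) ≡ pt (suc (d + d) + suc (m + m)) (suc (d + d) + 0)
    corner m d m+d = cong₂ pt (trans (cong (λ z → z + z) (sym m+d)) (spread m d)) (sym (+-identityʳ _))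
      where spread : ∀ m d → suc (m + d) + suc (m + d) ≡ suc (d + d) + suc (m + m)
            spread = solve-∀

    corner-bounds : ∀ m d → suc (m + d) ≡ n → suc (d + d) + suc (m + m) ≤ n + n × suc (d + d) + 0 ≤ n + n
    corner-bounds m d m+d =
      ≤-reflexive (sym x≡) , ≤-trans (≤-reflexive (+-identityʳ _)) (≤-trans (m≤m+n _ _) (≤-reflexive (sym x≡)))
      where x≡ : n + n ≡ suc (d + d) + suc (m + m)
            x≡ = proj₁ (pt-injective (corner m d m+d))

    split-< : ∀ {m d} → suc (m + d) ≡ n → m < n × d < n
    split-< {m} {d} m+d = ≤-trans (s≤s (m≤m+n m d)) (≤-reflexive m+d) , ≤-trans (s≤s (m≤n+m d m)) (≤-reflexive m+d)

  bottom-↗ : ∀ {m d} → suc (m + d) ≡ n → next B (n + n + m , ↗) ≡ (n + n + n + d , ↖)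
  bottom-↗ {m} {d} m+d = next-≡ B (n + n + m) ↗ (nth-bottom (proj₁ (split-< m+d)))
    (travel-↗ (d + d) (suc (m + m)) 0 (pt (suc (m + m)) 0) (pt (n + n) (suc (d + d))) refl (corner m d m+d) z≤n
      (proj₁ (corner-bounds m d m+d)) (proj₂ (corner-bounds m d m+d)) (indexOf-right (proj₂ (split-< m+d))))
    (nth-right (proj₂ (split-< m+d)))

  right-↙ : ∀ {m d} → suc (m + d) ≡ n → next B (n + n + n + d , ↙) ≡ (n + n + m , ↖)
  right-↙ {m} {d} m+d = next-≡ B (n + n + n + d) ↙ (nth-right (proj₂ (split-< m+d)))
    (travel-↙ (d + d) (suc (m + m)) 0 (pt (n + n) (suc (d + d))) (pt (suc (m + m)) 0) (corner m d m+d) refl z≤n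
      (proj₁ (corner-bounds m d m+d)) (proj₂ (corner-bounds m d m+d)) (indexOf-bottom (proj₁ (split-< m+d))))
    (nth-bottom (proj₁ (split-< m+d)))

  bottom₀-↖ : next B (n + n + 0 , ↖) ≡ (0 , ↗)
  bottom₀-↖ = next-≡ B (n + n + 0) ↖ (nth-bottom (s≤s z≤n)) (travel-adjacent (pt 1 0) ↖ refl indexOf-first) nth-first

  bottom-↖ : ∀ {a} → suc a < n → next B (n + n + suc a , ↖) ≡ (suc a , reflectAt (stairDir a) ↖)
  bottom-↖ {a} h = next-≡ B (n + n + suc a) ↖ (nth-bottom h)
    (travel-↖ (2 + a) a 0 (pt (suc (suc a + suc a)) 0) (pt a (3 + a))
      (cong (λ z → pt (suc (suc z)) 0) (+-suc a a)) (cong (pt a) (sym (+-identityʳ _)))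
      (≤-reflexive (+-identityʳ _)) hx (≤-trans (+-monoʳ-≤ (3 + a) z≤n) hx)
      (indexOf-stair a<))
    (nth-stair a<)
    where
    a< : a < n′ + n′
    a< = ≤-trans (≤-pred h) (m≤m+n n′ n′)
    hx : 3 + a + a ≤ n + n
    hx = ≤-trans (m+n≡o⇒m≤o 1 (spread a)) (+-mono-≤ h h)
      where spread : ∀ a → 3 + a + a + 1 ≡ 2 + a + (2 + a)
            spread = solve-∀

  right-↖ : ∀ {d} → d < n′ → next B (n + n + n + d , ↖) ≡ (suc (n′ + d) , reflectAt (stairDir (n′ + d)) ↖)
  right-↖ {d} d< with m≤n⇒∃[o]m+o≡n d<
  ... | s , d+s = next-≡ B (n + n + n + d) ↖ (nth-right (≤-trans d< (n≤1+n n′)))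
    (travel-↖ (2 + s) (n′ + d) (suc (d + d)) (pt (n + n) (suc (d + d))) (pt (n′ + d) (3 + (n′ + d)))
      (cong (λ z → pt z (suc (d + d))) across) (cong (pt (n′ + d)) (sym up))
      (≤-reflexive up) (≤-reflexive (sym across)) (≤-trans (≤-reflexive up) stair≤)
      (indexOf-stair a<))
    (nth-stair a<)
    where
    a< : n′ + d < n′ + n′
    a< = +-monoʳ-< n′ d<
    n′≡ : n′ ≡ suc (d + s)
    n′≡ = sym d+s
    across : n + n ≡ 3 + s + (n′ + d)
    across = trans (cong (λ z → suc z + suc z) n′≡) (trans (spread d s) (cong (λ z → 3 + s + (z + d)) (sym n′≡)))
      where spread : ∀ d s → suc (suc (d + s)) + suc (suc (d + s)) ≡ 3 + s + (suc (d + s) + d)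
            spread = solve-∀
    up : 3 + s + suc (d + d) ≡ 3 + (n′ + d)
    up = trans (spread d s) (cong (λ z → 3 + (z + d)) (sym n′≡))
      where spread : ∀ d s → 3 + s + suc (d + d) ≡ 3 + (suc (d + s) + d)
            spread = solve-∀
    stair≤ : 3 + (n′ + d) ≤ n + n
    stair≤ = ≤-trans (s≤s (s≤s a<)) (≤-reflexive 2+2n′≡n+n)

  bottom-↖-stairN : ∀ {d} → suc (d + d) < n → next B (n + n + suc (d + d) , ↖) ≡ (suc (d + d) , ↗)
  bottom-↖-stairN {d} h = trans (bottom-↖ h) (cong (λ u → (suc (d + d) , reflectAt u ↖)) (stairDir-even d))

  bottom-↖-stairE : ∀ {d} → 2 + (d + d) < n → next B (n + n + (2 + (d + d)) , ↖) ≡ (2 + (d + d) , ↙)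
  bottom-↖-stairE {d} h = trans (bottom-↖ h) (cong (λ u → (2 + (d + d) , reflectAt u ↖)) (stairDir-odd d))

  right-↖-stairN : ∀ {c d} → c < n′ → n + d ≡ suc (c + c) → next B (n + n + n + d , ↖) ≡ (suc (c + c) , ↗)
  right-↖-stairN {c} {d} c< n+d = trans (right-↖ d<)
    (trans (cong (λ a → (suc a , reflectAt (stairDir a) ↖)) a≡)
           (cong (λ u → (suc (c + c) , reflectAt u ↖)) (stairDir-even c)))
    where
    a≡ : n′ + d ≡ c + c
    a≡ = suc-injective n+d
    d< : d < n′
    d< = +-cancelˡ-< n′ d n′ (subst (_< n′ + n′) (sym a≡) (+-mono-< c< c<))

  cycle-fits : ∀ {k} → k ≤ 7 → k < length B + length B
  cycle-fits ≤7 = ≤-trans (s≤s ≤7) (+-mono-≤ 4≤ 4≤)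
    where
    1≤n : 1 ≤ n
    1≤n = s≤s z≤n
    4≤ : 4 ≤ length B
    4≤ = ≤-trans (+-mono-≤ (+-mono-≤ (+-mono-≤ 1≤n 1≤n) 1≤n) 1≤n) (≤-reflexive (sym length-B))

  non-leader-by-step : ∀ i {m u j d} → nth B i ≡ just (m , u) → next B (i , emit u) ≡ (j , d) → j < i →
                       isLeader B i ≡ false
  non-leader-by-step i {m} {u} hi step j<i =
    non-leader {B} {i} {m} {u} 0 hi (cycle-fits z≤n) (subst (λ s → index s < i) (sym step) j<i)

  below-lower : ∀ {i} j → i < n → i < n + n + j
  below-lower j i< = ≤-trans i< (≤-trans (m≤m+n n n) (m≤m+n (n + n) j))

  below-right : ∀ {i} j → i < n → i < n + n + n + j
  below-right j i< = ≤-trans (below-lower n i<) (m≤m+n (n + n + n) j)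

-- The three kinds of light cycles

module MainCycle (n′ : ℕ) where
  open Polygon n′

  states : List State
  states = (0 , ↗) ∷ (suc (n′ + n′) , ↘) ∷ (n + n + n + n′ , ↙) ∷ (n + n + 0 , ↖) ∷ []

  cycle : Chain (next B) (0 , ↗) states
  cycle = first-↗ ∷ last-↘ ∷ right-↙ {0} {n′} refl ∷ [ bottom₀-↖ ]

  fits : 3 < length B + length B
  fits = cycle-fits (m≤m+n 3 4)

  first-leads : isLeader B 0 ≡ true
  first-leads = leader {B} {0} nth-first (λ _ → z≤n)

  last-follows : isLeader B (suc (n′ + n′)) ≡ false
  last-follows = non-leader-on-cycle B _ cycle fits nth-last (there (here refl)) (s≤s z≤n)

  right-follows : isLeader B (n + n + n + n′) ≡ false
  right-follows = non-leader-on-cycle B _ cycle fits (nth-right ≤-refl) (there (there (here refl))) (s≤s z≤n)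

  bottom-follows : isLeader B (n + n + 0) ≡ false
  bottom-follows =
    non-leader-on-cycle B _ cycle fits (nth-bottom (s≤s z≤n)) (there (there (there (here refl)))) (s≤s z≤n)

module ShortCycle (k : ℕ) where
  open Polygon (suc (k + k))

  k< : k < suc (k + k)
  k< = s≤s (m≤m+n k k)

  states : List State
  states = (suc (k + k) , ↗) ∷ (2 + (k + k) , ↘) ∷ (n + n + n + 0 , ↙) ∷ (n + n + suc (k + k) , ↖) ∷ []

  cycle : Chain (next B) (suc (k + k) , ↗) states
  cycle = stairN-↗ k< ∷ stairE-↘-right k< (+-identityʳ n) ∷ right-↙ {suc (k + k)} {0} (cong suc (+-identityʳ _))
        ∷ [ bottom-↖-stairN {k} ≤-refl ]

  fits : 3 < length B + length B
  fits = cycle-fits (m≤m+n 3 4)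

  stairN-leads : isLeader B (suc (k + k)) ≡ true
  stairN-leads = leader-on-cycle B _ cycle (nth-stairN k<) (here refl)
    (≤-refl ∷ n≤1+n _ ∷ <⇒≤ (below-right 0 ≤-refl) ∷ <⇒≤ (below-lower _ ≤-refl) ∷ [])

  stairE-follows : isLeader B (2 + (k + k)) ≡ false
  stairE-follows = non-leader-on-cycle B _ cycle fits (nth-stairE k<) (there (here refl)) ≤-refl

  right-follows : isLeader B (n + n + n + 0) ≡ false
  right-follows =
    non-leader-on-cycle B _ cycle fits (nth-right (s≤s z≤n)) (there (there (here refl))) (below-right 0 ≤-refl)

  bottom-follows : isLeader B (n + n + suc (k + k)) ≡ false
  bottom-follows =
    non-leader-on-cycle B _ cycle fits (nth-bottom ≤-refl) (there (there (there (here refl)))) (below-lower _ ≤-refl)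

module LongCycle (k e : ℕ) where
  n′ : ℕ
  n′ = 2 + (k + k + e)

  open Polygon n′

  c : ℕ
  c = suc (k + e)

  k< : k < n′
  k< = s≤s (≤-trans (m≤m+n k k) (≤-trans (m≤m+n (k + k) e) (n≤1+n _)))

  c< : c < n′
  c< = m+n≡o⇒m≤o k (regroup k e)
    where regroup : ∀ k e → suc (suc (k + e)) + k ≡ 2 + (k + k + e)
          regroup = solve-∀

  2+2k< : 2 + (k + k) < n
  2+2k< = s≤s (s≤s (s≤s (m≤m+n (k + k) e)))

  1+2k< : suc (k + k) < n
  1+2k< = <-trans (n<1+n _) 2+2k<

  e< : e < n
  e< = s≤s (≤-trans (m≤n+m e (k + k)) (≤-trans (n≤1+n _) (n≤1+n _)))

  1+e< : suc e < n
  1+e< = s≤s (s≤s (≤-trans (m≤n+m e (k + k)) (n≤1+n _)))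

  states : List State
  states = (suc (k + k) , ↗) ∷ (2 + (k + k) , ↘) ∷ (n + n + (2 + (k + k)) , ↗) ∷ (n + n + n + e , ↖)
         ∷ (suc (c + c) , ↗) ∷ (2 + (c + c) , ↘) ∷ (n + n + n + suc e , ↙) ∷ (n + n + suc (k + k) , ↖) ∷ []

  cycle : Chain (next B) (suc (k + k) , ↗) states
  cycle = stairN-↗ k< ∷ stairE-↘-bottom {k} 2+2k< ∷ bottom-↗ {2 + (k + k)} {e} refl ∷ right-↖-stairN c< (to-stair k e)
        ∷ stairN-↗ c< ∷ stairE-↘-right c< (to-right k e) ∷ right-↙ {suc (k + k)} {suc e} (to-bottom k e)
        ∷ [ bottom-↖-stairN {k} 1+2k< ]
    where
    to-stair : ∀ k e → 3 + (k + k + e) + e ≡ suc (suc (k + e) + suc (k + e))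
    to-stair = solve-∀
    to-right : ∀ k e → 3 + (k + k + e) + suc e ≡ 2 + (suc (k + e) + suc (k + e))
    to-right = solve-∀
    to-bottom : ∀ k e → suc (suc (k + k) + suc e) ≡ 3 + (k + k + e)
    to-bottom = solve-∀

  fits : 7 < length B + length B
  fits = cycle-fits ≤-refl

  1+2k<1+2c : suc (k + k) < suc (c + c)
  1+2k<1+2c = s≤s (+-mono-< (s≤s (m≤m+n k e)) (s≤s (m≤m+n k e)))

  stairN-lower-leads : isLeader B (suc (k + k)) ≡ true
  stairN-lower-leads = leader-on-cycle B _ cycle (nth-stairN k<) (here refl)
    (≤-refl ∷ n≤1+n _ ∷ <⇒≤ (below-lower _ 1+2k<) ∷ <⇒≤ (below-right _ 1+2k<) ∷ <⇒≤ 1+2k<1+2c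
     ∷ ≤-trans (<⇒≤ 1+2k<1+2c) (n≤1+n _) ∷ <⇒≤ (below-right _ 1+2k<) ∷ <⇒≤ (below-lower _ 1+2k<) ∷ [])

  stairE-lower-follows : isLeader B (2 + (k + k)) ≡ false
  stairE-lower-follows = non-leader-on-cycle B _ cycle fits (nth-stairE k<) (there (here refl)) ≤-refl

  stairN-upper-follows : isLeader B (suc (c + c)) ≡ false
  stairN-upper-follows =
    non-leader-on-cycle B _ cycle fits (nth-stairN c<) (there (there (there (there (here refl))))) 1+2k<1+2c

  stairE-upper-follows : isLeader B (2 + (c + c)) ≡ false
  stairE-upper-follows =
    non-leader-on-cycle B _ cycle fits (nth-stairE c<) (there (there (there (there (there (here refl))))))
      (≤-trans 1+2k<1+2c (n≤1+n _))

  right-upper-follows : isLeader B (n + n + n + suc e) ≡ false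
  right-upper-follows =
    non-leader-on-cycle B _ cycle fits (nth-right 1+e<) (there (there (there (there (there (there (here refl)))))))
      (below-right _ 1+2k<)

  bottom-left-follows : isLeader B (n + n + suc (k + k)) ≡ false
  bottom-left-follows =
    non-leader-on-cycle B _ cycle fits (nth-bottom 1+2k<) (there (there (there (there (there (there (there (here refl))))))))
      (below-lower _ 1+2k<)

  -- The remaining two steps of the cycle emit their beams against its direction.

  bottom-right-follows : isLeader B (n + n + (2 + (k + k))) ≡ false
  bottom-right-follows =
    non-leader-by-step (n + n + (2 + (k + k))) (nth-bottom 2+2k<) (bottom-↖-stairE {k} 2+2k<) (below-lower _ 2+2k<)

  right-lower-follows : isLeader B (n + n + n + e) ≡ false
  right-lower-follows = non-leader-by-step (n + n + n + e) (nth-right e<) (right-↙ {2 + (k + k)} {e} refl)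
    (≤-trans (+-monoʳ-< (n + n) 2+2k<) (m≤m+n (n + n + n) e))

-- Classifying the boundary steps

bottomIndex rightIndex : ℕ → ℕ → ℕ
bottomIndex n′ m = suc n′ + suc n′ + m
rightIndex  n′ d = suc n′ + suc n′ + suc n′ + d

data Role : ℕ → ℕ → Set where
  main-first        : ∀ n′ → Role n′ 0
  main-last         : ∀ n′ → Role n′ (suc (n′ + n′))
  main-right        : ∀ n′ → Role n′ (rightIndex n′ n′)
  main-bottom       : ∀ n′ → Role n′ (bottomIndex n′ 0)
  short-stairN      : ∀ k → Role (suc (k + k)) (suc (k + k))
  short-stairE      : ∀ k → Role (suc (k + k)) (2 + (k + k))
  short-right       : ∀ k → Role (suc (k + k)) (rightIndex (suc (k + k)) 0)
  short-bottom      : ∀ k → Role (suc (k + k)) (bottomIndex (suc (k + k)) (suc (k + k)))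
  long-stairN-lower : ∀ k e → Role (2 + (k + k + e)) (suc (k + k))
  long-stairE-lower : ∀ k e → Role (2 + (k + k + e)) (2 + (k + k))
  long-bottom-right : ∀ k e → Role (2 + (k + k + e)) (bottomIndex (2 + (k + k + e)) (2 + (k + k)))
  long-right-lower  : ∀ k e → Role (2 + (k + k + e)) (rightIndex (2 + (k + k + e)) e)
  long-stairN-upper : ∀ k e → Role (2 + (k + k + e)) (suc (suc (k + e) + suc (k + e)))
  long-stairE-upper : ∀ k e → Role (2 + (k + k + e)) (2 + (suc (k + e) + suc (k + e)))
  long-right-upper  : ∀ k e → Role (2 + (k + k + e)) (rightIndex (2 + (k + k + e)) (suc e))
  long-bottom-left  : ∀ k e → Role (2 + (k + k + e)) (bottomIndex (2 + (k + k + e)) (suc (k + k)))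

oddᵇ : ℕ → Bool
oddᵇ zero          = false
oddᵇ (suc zero)    = true
oddᵇ (suc (suc i)) = oddᵇ i

oddᵇ-double : ∀ k → oddᵇ (k + k) ≡ false
oddᵇ-double zero    = refl
oddᵇ-double (suc k) rewrite +-suc k k = oddᵇ-double k

oddᵇ-suc-double : ∀ k → oddᵇ (suc (k + k)) ≡ true
oddᵇ-suc-double zero    = refl
oddᵇ-suc-double (suc k) rewrite +-suc k k = oddᵇ-suc-double k

oddBelow : ℕ → ℕ → Bool
oddBelow n i = oddᵇ i ∧ (i ℕ.<ᵇ n)

leading : ℕ → ℕ → Bool
leading n i = (i ℕ.≡ᵇ 0) ∨ oddBelow n i

leading-odd : ∀ {n} k → suc (k + k) < n → leading n (suc (k + k)) ≡ true
leading-odd {n} k h with suc (k + k) ℕ.<ᵇ n | <⇒<ᵇ h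
... | true | _ rewrite oddᵇ-suc-double k = refl

leading-even : ∀ n k → leading n (2 + (k + k)) ≡ false
leading-even n k rewrite oddᵇ-double k = refl

leading-≥ : ∀ n′ i → suc n′ ≤ i → leading (suc n′) i ≡ false
leading-≥ n′ (suc i) n≤ with suc i ℕ.<ᵇ suc n′ in eq
... | false = ∧-zeroʳ (oddᵇ (suc i))
... | true  = ⊥-elim (<⇒≱ (<ᵇ⇒< (suc i) (suc n′) (subst T (sym eq) _)) n≤)

≤-bottomIndex : ∀ n′ m → suc n′ ≤ bottomIndex n′ m
≤-bottomIndex n′ m = ≤-trans (m≤m+n (suc n′) (suc n′)) (m≤m+n _ m)

≤-rightIndex : ∀ n′ d → suc n′ ≤ rightIndex n′ d
≤-rightIndex n′ d = ≤-trans (≤-bottomIndex n′ (suc n′)) (m≤m+n _ d)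

isLeader-role : ∀ {n′ i} → Role n′ i → isLeader (Polygon.B n′) i ≡ leading (suc n′) i
isLeader-role (main-first n′)  = MainCycle.first-leads n′
isLeader-role (main-last n′)   =
  trans (MainCycle.last-follows n′) (sym (leading-≥ n′ _ (s≤s (m≤m+n n′ n′))))
isLeader-role (main-right n′)  =
  trans (MainCycle.right-follows n′) (sym (leading-≥ n′ _ (≤-rightIndex n′ n′)))
isLeader-role (main-bottom n′) =
  trans (MainCycle.bottom-follows n′) (sym (leading-≥ n′ _ (≤-bottomIndex n′ 0)))
isLeader-role (short-stairN k) =
  trans (ShortCycle.stairN-leads k) (sym (leading-odd k ≤-refl))
isLeader-role (short-stairE k) =
  trans (ShortCycle.stairE-follows k) (sym (leading-even (2 + (k + k)) k))
isLeader-role (short-right k)  =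
  trans (ShortCycle.right-follows k) (sym (leading-≥ (suc (k + k)) _ (≤-rightIndex _ 0)))
isLeader-role (short-bottom k) =
  trans (ShortCycle.bottom-follows k) (sym (leading-≥ (suc (k + k)) _ (≤-bottomIndex _ _)))
isLeader-role (long-stairN-lower k e) =
  trans (LongCycle.stairN-lower-leads k e) (sym (leading-odd k (LongCycle.1+2k< k e)))
isLeader-role (long-stairE-lower k e) =
  trans (LongCycle.stairE-lower-follows k e) (sym (leading-even (3 + (k + k + e)) k))
isLeader-role (long-bottom-right k e) =
  trans (LongCycle.bottom-right-follows k e) (sym (leading-≥ (2 + (k + k + e)) _ (≤-bottomIndex _ _)))
isLeader-role (long-right-lower k e) =
  trans (LongCycle.right-lower-follows k e) (sym (leading-≥ (2 + (k + k + e)) _ (≤-rightIndex _ _)))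
isLeader-role (long-stairN-upper k e) =
  trans (LongCycle.stairN-upper-follows k e) (sym (leading-≥ (2 + (k + k + e)) _ (m+n≡o⇒m≤o e (spread k e))))
  where spread : ∀ k e → 3 + (k + k + e) + e ≡ suc (suc (k + e) + suc (k + e))
        spread = solve-∀
isLeader-role (long-stairE-upper k e) =
  trans (LongCycle.stairE-upper-follows k e) (sym (leading-even (3 + (k + k + e)) (suc (k + e))))
isLeader-role (long-right-upper k e) =
  trans (LongCycle.right-upper-follows k e) (sym (leading-≥ (2 + (k + k + e)) _ (≤-rightIndex _ _)))
isLeader-role (long-bottom-left k e) =
  trans (LongCycle.bottom-left-follows k e) (sym (leading-≥ (2 + (k + k + e)) _ (≤-bottomIndex _ _)))

data Parity : ℕ → Set where
  even : ∀ d → Parity (d + d)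
  odd  : ∀ d → Parity (suc (d + d))

parity : ∀ j → Parity j
parity zero = even 0
parity (suc j) with parity j
... | even d = odd d
... | odd d  = subst Parity (cong suc (+-suc d d)) (even (suc d))

data Region (n′ : ℕ) : ℕ → Set where
  first  : Region n′ 0
  stair  : ∀ a → a < n′ + n′ → Region n′ (suc a)
  last   : Region n′ (suc (n′ + n′))
  bottom : ∀ m → m < suc n′ → Region n′ (bottomIndex n′ m)
  right  : ∀ d → d < suc n′ → Region n′ (rightIndex n′ d)

bottomIndex-unfold : ∀ n′ m → bottomIndex n′ m ≡ suc (suc (n′ + n′) + m)
bottomIndex-unfold = unfold
  where unfold : ∀ k m → suc k + suc k + m ≡ suc (suc (k + k) + m)
        unfold = solve-∀

rightIndex-unfold : ∀ n′ d → rightIndex n′ d ≡ suc (suc (n′ + n′) + (suc n′ + d))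
rightIndex-unfold = unfold
  where unfold : ∀ k d → suc k + suc k + suc k + d ≡ suc (suc (k + k) + (suc k + d))
        unfold = solve-∀

region : ∀ n′ i → i < rightIndex n′ (suc n′) → Region n′ i
region n′ zero    _  = first
region n′ (suc a) i< with <-cmp a (n′ + n′)
... | tri< a< _ _   = stair a a<
... | tri≈ _ refl _ = last
... | tri> _ _ a>   with m≤n⇒∃[o]m+o≡n a>
...   | m , refl with m <? suc n′
...     | yes m< = subst (Region n′) (bottomIndex-unfold n′ m) (bottom m m<)
...     | no m≮ with m≤n⇒∃[o]m+o≡n (≮⇒≥ m≮)
...       | d , refl = subst (Region n′) (rightIndex-unfold n′ d)
                         (right d (+-cancelˡ-< (suc n′ + suc n′ + suc n′) d (suc n′)
                                    (subst (_< rightIndex n′ (suc n′)) (sym (rightIndex-unfold n′ d)) i<)))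

upper-half : ∀ d k → suc d + k < suc (d + d) → suc k ≤ d
upper-half d k gt = +-cancelˡ-≤ d (suc k) d (subst (_≤ d + d) (sym (+-suc d k)) (≤-pred gt))

stairN-role : ∀ n′ d → d < n′ → Role n′ (suc (d + d))
stairN-role n′ d d< with <-cmp (suc (d + d)) n′
... | tri< lt _ _ with m≤n⇒∃[o]m+o≡n lt
...   | e , refl = long-stairN-lower d e
stairN-role n′ d d< | tri≈ _ refl _ = short-stairN d
stairN-role n′ d d< | tri> _ _ gt with m≤n⇒∃[o]m+o≡n d<
... | k , refl with m≤n⇒∃[o]m+o≡n (upper-half d k gt)
...   | e , refl = subst (λ N → Role N (suc (suc (k + e) + suc (k + e)))) (regroup k e) (long-stairN-upper k e)
  where regroup : ∀ k e → 2 + (k + k + e) ≡ suc (suc (k + e)) + k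
        regroup = solve-∀

stairE-role : ∀ n′ d → d < n′ → Role n′ (2 + (d + d))
stairE-role n′ d d< with <-cmp (suc (d + d)) n′
... | tri< lt _ _ with m≤n⇒∃[o]m+o≡n lt
...   | e , refl = long-stairE-lower d e
stairE-role n′ d d< | tri≈ _ refl _ = short-stairE d
stairE-role n′ d d< | tri> _ _ gt with m≤n⇒∃[o]m+o≡n d<
... | k , refl with m≤n⇒∃[o]m+o≡n (upper-half d k gt)
...   | e , refl = subst (λ N → Role N (2 + (suc (k + e) + suc (k + e)))) (regroup k e) (long-stairE-upper k e)
  where regroup : ∀ k e → 2 + (k + k + e) ≡ suc (suc (k + e)) + k
        regroup = solve-∀

stair-role : ∀ n′ a → a < n′ + n′ → Role n′ (suc a)
stair-role n′ a a< with parity a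
... | even d = stairN-role n′ d (double-<⁻ a<)
... | odd d  = stairE-role n′ d (double-<⁻ (<-trans (n<1+n (d + d)) a<))

bottom-role : ∀ n′ m → m < suc n′ → Role n′ (bottomIndex n′ m)
bottom-role n′ zero    _  = main-bottom n′
bottom-role n′ (suc j) m< with parity j
... | odd k with m≤n⇒∃[o]m+o≡n (≤-pred m<)
...   | e , refl = long-bottom-right k e
bottom-role n′ (suc j) m< | even k with m≤n⇒m<n∨m≡n (≤-pred m<)
... | inj₂ refl = short-bottom k
... | inj₁ lt with m≤n⇒∃[o]m+o≡n lt
...   | e , refl = long-bottom-left k e

right-role : ∀ n′ d → d < suc n′ → Role n′ (rightIndex n′ d)
right-role n′ d d< with m≤n⇒m<n∨m≡n (≤-pred d<)
... | inj₂ refl = main-right n′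
... | inj₁ lt with m≤n⇒∃[o]m+o≡n lt
...   | r , refl = below-top d r
  where
  below-top : ∀ d r → Role (suc d + r) (rightIndex (suc d + r) d)
  below-top d r with parity r
  below-top zero    .(k + k) | even k = short-right k
  below-top (suc e) .(k + k) | even k =
    subst (λ N → Role N (rightIndex N (suc e))) (regroup k e) (long-right-upper k e)
    where regroup : ∀ k e → 2 + (k + k + e) ≡ suc (suc e) + (k + k)
          regroup = solve-∀
  below-top d .(suc (k + k)) | odd k =
    subst (λ N → Role N (rightIndex N d)) (regroup k d) (long-right-lower k d)
    where regroup : ∀ k d → 2 + (k + k + d) ≡ suc d + suc (k + k)
          regroup = solve-∀

role : ∀ n′ i → i < rightIndex n′ (suc n′) → Role n′ i
role n′ i i< with region n′ i i<
... | first       = main-first n′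
... | last        = main-last n′
... | stair a a<  = stair-role n′ a a<
... | bottom m m< = bottom-role n′ m m<
... | right d d<  = right-role n′ d d<

-- Counting the cycles

count : (ℕ → Bool) → List ℕ → ℕ
count p xs = length (filterᵇ p xs)

filterᵇ-cong : ∀ {p q} {xs : List ℕ} → All (λ x → p x ≡ q x) xs → filterᵇ p xs ≡ filterᵇ q xs
filterᵇ-cong {xs = []}         []            = refl
filterᵇ-cong {p} {q} {x ∷ xs} (px≡qx ∷ eqs) rewrite px≡qx with q x
... | true  = cong (x ∷_) (filterᵇ-cong eqs)
... | false = filterᵇ-cong eqs

count-applyUpTo : ∀ p f g L → count p (applyUpTo (f ∘ g) L) ≡ count (p ∘ f) (applyUpTo g L)
count-applyUpTo p f g zero    = refl
count-applyUpTo p f g (suc L) with p (f (g 0))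
... | true  = cong suc (count-applyUpTo p f (g ∘ suc) L)
... | false = count-applyUpTo p f (g ∘ suc) L

count-none : ∀ {p} (xs : List ℕ) → (∀ x → p x ≡ false) → count p xs ≡ 0
count-none         []       _    = refl
count-none {p} (x ∷ xs) none rewrite none x = count-none xs none

count-oddBelow : ∀ m L → m ≤ L → count (oddBelow m) (upTo L) ≡ ⌊ m /2⌋
count-oddBelow zero                L             _ = count-none (upTo L) (λ x → ∧-zeroʳ (oddᵇ x))
count-oddBelow (suc zero)          (suc L)       _ =
  trans (count-applyUpTo (oddBelow 1) suc (λ x → x) L) (count-none (upTo L) (λ x → ∧-zeroʳ (oddᵇ (suc x))))
count-oddBelow (suc (suc m)) (suc (suc L)) (s≤s (s≤s m≤L)) =
  trans (count-applyUpTo (oddBelow (2 + m)) suc (λ x → x) (suc L))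
    (cong suc (trans (count-applyUpTo (oddBelow (2 + m) ∘ suc) suc (λ x → x) L) (count-oddBelow m L m≤L)))

count-leading : ∀ n L → n ≤ suc L → count (leading n) (upTo (suc L)) ≡ suc ⌊ n /2⌋
count-leading n L n≤ = cong suc (begin
  count (leading n) (applyUpTo suc L)  ≡⟨ count-applyUpTo (leading n) suc (λ x → x) L ⟩
  count (oddBelow n ∘ suc) (upTo L)    ≡⟨ sym (count-applyUpTo (oddBelow n) suc (λ x → x) L) ⟩
  count (oddBelow n) (upTo (suc L))    ≡⟨ count-oddBelow n (suc L) n≤ ⟩
  ⌊ n /2⌋ ∎)
  where open ≡-Reasoning

traj-Zstar : ∀ n′ → traj (suc n′) (Zstar (suc n′)) ≡ suc ⌊ suc n′ /2⌋
traj-Zstar n′ = begin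
  traj n (Zstar n)                           ≡⟨ cong (count (isLeader B) ∘ upTo) length-B ⟩
  count (isLeader B) (upTo (n + n + n + n))  ≡⟨ cong length (filterᵇ-cong (applyUpTo⁺₁ (λ x → x) (n + n + n + n)
                                                   (λ i< → isLeader-role (role n′ _ i<)))) ⟩
  count (leading n) (upTo (n + n + n + n))   ≡⟨ count-leading n _ n≤4n ⟩
  suc ⌊ n /2⌋ ∎
  where
  open Polygon n′
  open ≡-Reasoning
  n≤4n : n ≤ n + n + n + n
  n≤4n = ≤-trans (m≤m+n n n) (≤-trans (m≤m+n (n + n) n) (m≤m+n (n + n + n) n))

-- `(4 + n) % 4` and `⌊ 4 + n /2⌋` reduce to `n % 4` and `2 + ⌊ n /2⌋`, so the claim is 4-periodic.
leaders-parity : ∀ n → ((n % 4 ≡ 0 ⊎ n % 4 ≡ 1) → suc ⌊ n /2⌋ % 2 ≡ 1) ×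
                       ((n % 4 ≡ 2 ⊎ n % 4 ≡ 3) → suc ⌊ n /2⌋ % 2 ≡ 0)
leaders-parity 0 = (λ _ → refl) , λ { (inj₁ ()) ; (inj₂ ()) }
leaders-parity 1 = (λ _ → refl) , λ { (inj₁ ()) ; (inj₂ ()) }
leaders-parity 2 = (λ { (inj₁ ()) ; (inj₂ ()) }) , (λ _ → refl)
leaders-parity 3 = (λ { (inj₁ ()) ; (inj₂ ()) }) , (λ _ → refl)
leaders-parity (suc (suc (suc (suc n)))) = leaders-parity n

lemma4p3 : (n : ℕ) → 2 ≤ n →
    ((n % 4 ≡ 0 ⊎ n % 4 ≡ 1) → traj n (Zstar n) % 2 ≡ 1) ×
    ((n % 4 ≡ 2 ⊎ n % 4 ≡ 3) → traj n (Zstar n) % 2 ≡ 0)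
lemma4p3 (suc n′) _ rewrite traj-Zstar n′ = leaders-parity (suc n′)
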